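{- Let $n\ge5$. On the complex vector space $V$ with basis $\mathcal{A}_n=\{x_1^{\alpha_1}\cdots x_n^{\alpha_n}:0\le\alpha_j<j\}$ define, for $1\le i\le n-1$, linear operators $\overline{\pi}_i$ by $\overline{\pi}_i(x^\alpha)=0$ if $\alpha_i=\alpha_{i+1}$, $\overline{\pi}_i(x^\alpha)=-x^\alpha$ if $\alpha_i<\alpha_{i+1}$, and $\overline{\pi}_i(x^\alpha)=x^{s_i(\alpha)}$ if $\alpha_i>\alpha_{i+1}$, where $s_i(\alpha)$ swaps $\alpha_i$ and $\alpha_{i+1}$. Then for every $x^\alpha\in\mathcal{A}_n$, $\overline{\pi}_3\overline{\pi}_4\overline{\pi}_3(x^\alpha)=\overline{\pi}_4\overline{\pi}_3\overline{\pi}_4(x^\alpha)$.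
   Context: If $\alpha_i>\alpha_{i+1}$ and $x^\alpha\in\mathcal{A}_n$ then $x^{s_i(\alpha)}\in\mathcal{A}_n$, so the operators are well defined. -}

module Defs where

open import Data.Nat using (ℕ; zero; suc; _≤_)
open import Data.Nat.Properties using (<-cmp)
open import Data.Integer using (ℤ; +_; -[1+_]) renaming (_+_ to _+ℤ_; _*_ to _*ℤ_)
open import Data.Fin using (Fin; toℕ; inject₁)
open import Data.Vec using (Vec; lookup; _[_]≔_)
open import Data.Vec.Properties using (≡-dec)
open import Data.List using (List; []; _∷_; concatMap; map; foldr)
open import Data.Product using (_×_; _,_)
open import Relation.Nullary using (yes; no)
open import Relation.Binary using (tri<; tri≈; tri>)
open import Relation.Binary.PropositionalEquality using (_≡_)

-- Exponent vectors α = (α₁,…,αₙ), stored 0-indexed: lookup α j = α_{j+1}.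
Exp : ℕ → Set
Exp n = Vec ℕ n

-- x^α ∈ 𝒜ₙ  iff  0 ≤ α_j < j for all j (1-indexed), i.e. lookup α j ≤ toℕ j.
InA : ∀ {n} → Exp n → Set
InA {n} α = (j : Fin n) → lookup α j ≤ toℕ j

-- Vectors of the free module with basis the monomials x^α, as formal sums Σ c·x^α.
V : ℕ → Set
V n = List (ℤ × Exp n)

mono : ∀ {n} → Exp n → V n
mono α = (+ 1 , α) ∷ []

coeff : ∀ {n} → V n → Exp n → ℤ
coeff v γ = foldr (λ { (c , β) acc → sel c β +ℤ acc }) (+ 0) v
  where
  sel : ℤ → _ → ℤ
  sel c β with ≡-dec Data.Nat._≟_ β γ
  ... | yes _ = c
  ... | no _ = + 0

_≈V_ : ∀ {n} → V n → V n → Set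
v ≈V w = ∀ γ → coeff v γ ≡ coeff w γ

-- Here n = suc m, and i : Fin m (0-indexed) is the paper's index i+1 ∈ {1,…,n-1};
-- it acts on the paper's positions i+1, i+2, i.e. 0-indexed positions inject₁ i, suc i.
sᵢ : ∀ {m} → Fin m → Exp (suc m) → Exp (suc m)
sᵢ i α = (α [ inject₁ i ]≔ lookup α (Data.Fin.suc i)) [ Data.Fin.suc i ]≔ lookup α (inject₁ i)

π̄-basis : ∀ {m} → Fin m → Exp (suc m) → V (suc m)
π̄-basis i α with <-cmp (lookup α (inject₁ i)) (lookup α (Data.Fin.suc i))
... | tri< _ _ _ = (-[1+ 0 ] , α) ∷ []
... | tri≈ _ _ _ = []
... | tri> _ _ _ = (+ 1 , sᵢ i α) ∷ []

π̄ : ∀ {m} → Fin m → V (suc m) → V (suc m)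
π̄ i v = concatMap (λ { (c , α) → map (λ { (d , β) → (c *ℤ d , β) }) (π̄-basis i α) }) v

-- π̄ᵢ sends a basis vector to ±(a basis vector) or to 0, according to how αᵢ compares
-- with αᵢ₊₁, and only positions i, i+1 are involved. So the braid relation for
-- π̄ᵢ, π̄ᵢ₊₁ at x^α depends only on the relative order of (αᵢ, αᵢ₊₁, αᵢ₊₂): there are 13
-- such weak orders, and in each one both sides are traced to the same signed monomial
-- (or to 0). The relation then holds for every exponent vector, not only on 𝒜ₙ.
module Submission where

open import Defs
open import Data.Nat using (ℕ; suc; _<_; _≤_; s≤s; z≤n)
open import Data.Nat.Properties using (<-cmp; <-irrefl; <-asym; <-trans; ≤-trans)
open import Data.Fin using (Fin; zero; suc; inject₁; fromℕ<)
open import Data.Vec using (Vec; _∷_; lookup)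
open import Data.Integer using (+_; -[1+_]) renaming (_*_ to _*ℤ_)
open import Data.Product using (_,_; map₂)
open import Data.List using ([]; _∷_; map)
open import Data.Empty using (⊥-elim)
open import Relation.Binary using (Tri; tri<; tri≈; tri>)
open import Relation.Binary.PropositionalEquality using (_≡_; refl; sym; subst)

≡⇒≈V : ∀ {n} {v w : V n} → v ≡ w → v ≈V w
≡⇒≈V refl γ = refl

-- Tracing a computation through these
-- constructors (rather than through π̄ itself, which unfolds and blocks unification) lets
-- Agda infer every intermediate vector.
data _⟶[_]_ {m} : V (suc m) → Fin m → V (suc m) → Set where
  ascent  : ∀ {i c α} → lookup α (inject₁ i) < lookup α (suc i) →
            ((c , α) ∷ []) ⟶[ i ] ((c *ℤ -[1+ 0 ] , α) ∷ [])
  flat    : ∀ {i c α} → lookup α (inject₁ i) ≡ lookup α (suc i) →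
            ((c , α) ∷ []) ⟶[ i ] []
  descent : ∀ {i c α} → lookup α (suc i) < lookup α (inject₁ i) →
            ((c , α) ∷ []) ⟶[ i ] ((c *ℤ + 1 , sᵢ i α) ∷ [])
  nil     : ∀ {i} → [] ⟶[ i ] []

⟶-sound : ∀ {m} {i : Fin m} {v w} → v ⟶[ i ] w → π̄ i v ≡ w
⟶-sound {i = i} (ascent {α = α} lt) with <-cmp (lookup α (inject₁ i)) (lookup α (suc i))
... | tri< _ _ _  = refl
... | tri≈ _ eq _ = ⊥-elim (<-irrefl eq lt)
... | tri> _ _ gt = ⊥-elim (<-asym lt gt)
⟶-sound {i = i} (flat {α = α} eq) with <-cmp (lookup α (inject₁ i)) (lookup α (suc i))
... | tri< lt _ _ = ⊥-elim (<-irrefl eq lt)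
... | tri≈ _ _ _  = refl
... | tri> _ _ gt = ⊥-elim (<-irrefl (sym eq) gt)
⟶-sound {i = i} (descent {α = α} gt) with <-cmp (lookup α (inject₁ i)) (lookup α (suc i))
... | tri< lt _ _ = ⊥-elim (<-asym lt gt)
... | tri≈ _ eq _ = ⊥-elim (<-irrefl (sym eq) gt)
... | tri> _ _ _  = refl
⟶-sound nil = refl

data BraidSteps {m} (i j : Fin m) (v : V (suc m)) : Set where
  braid-steps : ∀ {v₁ v₂ u₁ u₂ w} →
                v ⟶[ i ] v₁ → v₁ ⟶[ j ] v₂ → v₂ ⟶[ i ] w →
                v ⟶[ j ] u₁ → u₁ ⟶[ i ] u₂ → u₂ ⟶[ j ] w →
                BraidSteps i j v

BraidSteps⇒braid : ∀ {m} {i j : Fin m} {v} → BraidSteps i j v →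
                   π̄ i (π̄ j (π̄ i v)) ≡ π̄ j (π̄ i (π̄ j v))
BraidSteps⇒braid (braid-steps p₁ p₂ p₃ q₁ q₂ q₃)
  rewrite ⟶-sound p₁ | ⟶-sound p₂ | ⟶-sound p₃ | ⟶-sound q₁ | ⟶-sound q₂ | ⟶-sound q₃ = refl

braidSteps-head : ∀ {m} x y z (r : Vec ℕ m) → BraidSteps zero (suc zero) (mono (x ∷ y ∷ z ∷ r))
braidSteps-head x y z r = by-order (<-cmp x y) (<-cmp y z) (<-cmp x z)
  where
  by-order : Tri (x < y) (x ≡ y) (y < x) → Tri (y < z) (y ≡ z) (z < y) → Tri (x < z) (x ≡ z) (z < x) →
             BraidSteps zero (suc zero) (mono (x ∷ y ∷ z ∷ r))
  by-order (tri< x<y _ _) (tri< y<z _ _) _ =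
    braid-steps (ascent x<y) (ascent y<z) (ascent x<y) (ascent y<z) (ascent x<y) (ascent y<z)
  by-order (tri< x<y _ _) (tri≈ _ y≡z _) _ =
    braid-steps (ascent x<y) (flat y≡z) nil (flat y≡z) nil nil
  by-order (tri< x<y _ _) (tri> _ _ z<y) (tri< x<z _ _) =
    braid-steps (ascent x<y) (descent z<y) (ascent x<z) (descent z<y) (ascent x<z) (ascent z<y)
  by-order (tri< x<y _ _) (tri> _ _ z<y) (tri≈ _ x≡z _) =
    braid-steps (ascent x<y) (descent z<y) (flat x≡z) (descent z<y) (flat x≡z) nil
  by-order (tri< x<y _ _) (tri> _ _ z<y) (tri> _ _ z<x) =
    braid-steps (ascent x<y) (descent z<y) (descent z<x) (descent z<y) (descent z<x) (ascent x<y)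
  by-order (tri≈ _ x≡y _) (tri< y<z _ _) _ =
    braid-steps (flat x≡y) nil nil (ascent y<z) (flat x≡y) nil
  by-order (tri≈ _ x≡y _) (tri≈ _ y≡z _) _ =
    braid-steps (flat x≡y) nil nil (flat y≡z) nil nil
  by-order (tri≈ _ x≡y _) (tri> _ _ z<y) _ =
    braid-steps (flat x≡y) nil nil (descent z<y) (descent (subst (z <_) (sym x≡y) z<y)) (flat x≡y)
  by-order (tri> _ _ y<x) (tri< y<z _ _) (tri< x<z _ _) =
    braid-steps (descent y<x) (ascent x<z) (ascent y<x) (ascent y<z) (descent y<x) (ascent x<z)
  by-order (tri> _ _ y<x) (tri< y<z _ _) (tri≈ _ x≡z _) =
    braid-steps (descent y<x) (flat x≡z) nil (ascent y<z) (descent y<x) (flat x≡z)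
  by-order (tri> _ _ y<x) (tri< y<z _ _) (tri> _ _ z<x) =
    braid-steps (descent y<x) (descent z<x) (ascent y<z) (ascent y<z) (descent y<x) (descent z<x)
  by-order (tri> _ _ y<x) (tri≈ _ y≡z _) _ =
    braid-steps (descent y<x) (descent (subst (_< x) y≡z y<x)) (flat y≡z) (flat y≡z) nil nil
  by-order (tri> _ _ y<x) (tri> _ _ z<y) _ =
    braid-steps (descent y<x) (descent z<x) (descent z<y) (descent z<y) (descent z<x) (descent y<x)
    where
    z<x : z < x
    z<x = <-trans z<y y<x

prepend : ∀ {n} → ℕ → V n → V (suc n)
prepend a = map (map₂ (a ∷_))

⟶-prepend : ∀ {m} {i : Fin m} {v w} a → v ⟶[ i ] w → prepend a v ⟶[ suc i ] prepend a w
⟶-prepend a (ascent lt)  = ascent lt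
⟶-prepend a (flat eq)    = flat eq
⟶-prepend a (descent gt) = descent gt
⟶-prepend a nil          = nil

BraidSteps-prepend : ∀ {m} {i j : Fin m} {v} a → BraidSteps i j v → BraidSteps (suc i) (suc j) (prepend a v)
BraidSteps-prepend a (braid-steps p₁ p₂ p₃ q₁ q₂ q₃) =
  braid-steps (⟶-prepend a p₁) (⟶-prepend a p₂) (⟶-prepend a p₃)
              (⟶-prepend a q₁) (⟶-prepend a q₂) (⟶-prepend a q₃)

braidSteps : ∀ {m} (i : Fin m) (α : Exp (suc (suc m))) → BraidSteps (inject₁ i) (suc i) (mono α)
braidSteps zero    (x ∷ y ∷ z ∷ r) = braidSteps-head x y z r
braidSteps (suc i) (a ∷ α)         = BraidSteps-prepend a (braidSteps i α)

π̄-braid : ∀ {m} (i : Fin m) (α : Exp (suc (suc m))) →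
          π̄ (inject₁ i) (π̄ (suc i) (π̄ (inject₁ i) (mono α)))
            ≡ π̄ (suc i) (π̄ (inject₁ i) (π̄ (suc i) (mono α)))
π̄-braid i α = BraidSteps⇒braid (braidSteps i α)

lemma7 : (m : ℕ) (hm : 4 ≤ m) (α : Exp (suc m)) → InA α →
    let π̄₃ = π̄ (fromℕ< {2} {m} (≤-trans (s≤s (s≤s (s≤s z≤n))) hm))
        π̄₄ = π̄ (fromℕ< {3} {m} hm)
    in π̄₃ (π̄₄ (π̄₃ (mono α))) ≈V π̄₄ (π̄₃ (π̄₄ (mono α)))
lemma7 (suc (suc (suc (suc k)))) (s≤s (s≤s (s≤s (s≤s z≤n)))) α _ = ≡⇒≈V (π̄-braid (suc (suc zero)) α)
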